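{- Let $a_1,a_2$ satisfy $0<a_1\le 2a_2$, and let $[\mathcal{E}_{n,k}]_{n,k\ge0}$ be defined by $\mathcal{E}_{0,0}=1$, $\mathcal{E}_{n,k}=0$ unless $0\le k\le n$, and for $n\ge1$ $$\mathcal{E}_{n,k}=(a_1k+a_2)\mathcal{E}_{n-1,k}+(a_1n-a_1k+a_2)\mathcal{E}_{n-1,k-1},$$ with $\mathcal{E}_n(x)=\sum_k\mathcal{E}_{n,k}x^k$. Then (for $x\ne1$) $$\mathcal{E}_n(x)=\Big(\frac{a_1\sqrt{ -1}}{2}\Big)^n(1-x)^n\,Q_n\!\left(\frac{2a_2}{a_1},\frac{1+x}{\sqrt{ -1}\,(1-x)}\right).$$
   Context: The general derivative polynomials $Q_n(\delta,t)$ are defined by $Q_0(\delta,t)=1$ and $Q_{n+1}(\delta,t)=(1+t^2)\frac{\partial}{\partial t}Q_n(\delta,t)+\delta\,t\,Q_n(\delta,t)$; equivalently $\frac{d^n}{ds^n}\sec^\delta s=Q_n(\delta,\tan s)\sec^\delta s$. -}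

module Defs where

open import Algebra.Bundles using (CommutativeRing)
open import Data.Nat using (ℕ; zero; suc)
open import Data.List using (List; []; _∷_; foldr)

module _ {c ℓ} (R : CommutativeRing c ℓ) where
  open CommutativeRing R hiding (zero)

  fromℕ : ℕ → Carrier
  fromℕ zero    = 0#
  fromℕ (suc n) = 1# + fromℕ n

  pow : Carrier → ℕ → Carrier
  pow x zero    = 1#
  pow x (suc n) = x * pow x n

  -- E_{n,k} = 0 for k>n follows from the recursion.
  E : Carrier → Carrier → ℕ → ℕ → Carrier
  E a1 a2 zero    zero    = 1#
  E a1 a2 zero    (suc k) = 0#
  E a1 a2 (suc n) zero    = (a1 * fromℕ zero + a2) * E a1 a2 n zero
  E a1 a2 (suc n) (suc k) =
    (a1 * fromℕ (suc k) + a2) * E a1 a2 n (suc k)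
    + ((a1 * fromℕ (suc n) + - (a1 * fromℕ (suc k))) + a2) * E a1 a2 n k

  sumTo : ℕ → (ℕ → Carrier) → Carrier
  sumTo zero    f = f zero
  sumTo (suc m) f = sumTo m f + f (suc m)

  -- 𝓔_n(x) = Σ_k 𝓔_{n,k} x^k  (terms with k > n vanish)
  Epoly : Carrier → Carrier → ℕ → Carrier → Carrier
  Epoly a1 a2 n x = sumTo n (λ k → E a1 a2 n k * pow x k)

  -- Polynomials in t as coefficient lists (constant term first).
  Poly : Set c
  Poly = List Carrier

  _+ₚ_ : Poly → Poly → Poly
  []       +ₚ q        = q
  (a ∷ p)  +ₚ []       = a ∷ p
  (a ∷ p)  +ₚ (b ∷ q)  = (a + b) ∷ (p +ₚ q)

  scaleₚ : Carrier → Poly → Poly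
  scaleₚ a []      = []
  scaleₚ a (b ∷ p) = (a * b) ∷ scaleₚ a p

  shiftₚ : Poly → Poly
  shiftₚ p = 0# ∷ p

  derivAux : ℕ → Poly → Poly
  derivAux k []      = []
  derivAux k (b ∷ p) = (fromℕ k * b) ∷ derivAux (suc k) p

  deriv : Poly → Poly
  deriv []      = []
  deriv (b ∷ p) = derivAux 1 p

  Q : Carrier → ℕ → Poly
  Q δ zero    = 1# ∷ []
  Q δ (suc n) =
    (deriv (Q δ n) +ₚ shiftₚ (shiftₚ (deriv (Q δ n)))) +ₚ scaleₚ δ (shiftₚ (Q δ n))

  evalₚ : Poly → Carrier → Carrier
  evalₚ p t = foldr (λ b acc → b + t * acc) 0# p

  Qeval : Carrier → ℕ → Carrier → Carrier
  Qeval δ n t = evalₚ (Q δ n) t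

{-# OPTIONS --safe #-}
-- Induction on n, simultaneously for all commutative rings. Summing the defining recurrence
-- gives 𝓔_{n+1}(x) = (a₂(1+x) + a₁nx) 𝓔_n(x) + a₁(1-x) θ𝓔_n(x) with θ = x d/dx, while
-- Q_{n+1} = (1+t²) Q_n' + δ t Q_n.  With c = a₁i/2 and t = -i(1+x)/(1-x) one has
-- c(1-x)δt = a₂(1+x) and c(1+t²) = a₁ θt, so the two recurrences match once θ of the n-th
-- identity is known.  As R is an arbitrary ring, that derivative is obtained by using the
-- induction hypothesis in the dual numbers R[ε] at x + xε: its ε-component is θ of both sides.
module Submission where

open import Defs
open import Algebra.Bundles using (CommutativeRing)
open import Algebra.Morphism.Structures using (IsRingHomomorphism)
import Algebra.Module.Construct.Idealization as Idealization
import Algebra.Module.Construct.TensorUnit as TensorUnit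
import Algebra.Solver.Ring
open import Algebra.Solver.Ring.AlmostCommutativeRing
  using (fromCommutativeRing; _-Raw-AlmostCommutative⟶_)
open import Data.Integer as ℤ using (ℤ; +_; -[1+_])
import Data.Integer.Properties as ℤP
open import Data.List using ([]; _∷_)
open import Data.List.Relation.Binary.Pointwise.Base using (Pointwise; []; _∷_)
open import Data.Maybe using (Maybe; just; nothing)
open import Data.Nat as ℕ using (ℕ; zero; suc; _<_; s≤s)
import Data.Nat.Properties as ℕP
open import Data.Product using (_,_; proj₁; proj₂)
open import Data.Sign as Sign using (Sign)
open import Level using (_⊔_)
import Relation.Binary.PropositionalEquality as ≡
open import Relation.Nullary using (yes; no)

module IntegerCoefficientSolver {c ℓ} (R : CommutativeRing c ℓ) where
  open CommutativeRing R
  open import Algebra.Properties.Ring ring using (-1*x≈-x; -‿involutive; -0#≈0#; -‿+-comm)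
  open import Algebra.Properties.Semiring.Mult.TCOptimised semiring
    using (×-homo-+; ×1-homo-*) renaming (_×_ to _·_)
  open import Algebra.Properties.CommutativeSemigroup +-commutativeSemigroup
    using () renaming (interchange to +-interchange)
  open import Algebra.Properties.CommutativeSemigroup *-commutativeSemigroup
    using () renaming (interchange to *-interchange)
  open import Relation.Binary.Reasoning.Setoid setoid

  -- The optimised multiple satisfies 1 · a = a definitionally, so the solver constants
  -- con (+ 0) and con (+ 1) evaluate to 0# and 1# on the nose.
  private
    fromℤ : ℤ → Carrier
    fromℤ (+ n)      = n · 1#
    fromℤ (-[1+ n ]) = - (suc n · 1#)

    σ : Sign → Carrier
    σ Sign.+ = 1#
    σ Sign.- = - 1#

    σ-homo : ∀ s t → σ (s Sign.* t) ≈ σ s * σ t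
    σ-homo Sign.+ t      = sym (*-identityˡ (σ t))
    σ-homo Sign.- Sign.+ = sym (*-identityʳ (- 1#))
    σ-homo Sign.- Sign.- = sym (trans (-1*x≈-x (- 1#)) (-‿involutive 1#))

    ◃-homo : ∀ s n → fromℤ (s ℤ.◃ n) ≈ σ s * (n · 1#)
    ◃-homo s      zero    = sym (zeroʳ (σ s))
    ◃-homo Sign.+ (suc n) = sym (*-identityˡ _)
    ◃-homo Sign.- (suc n) = sym (-1*x≈-x _)

    fromℤ-signAbs : ∀ i → fromℤ i ≈ σ (ℤ.sign i) * (ℤ.∣ i ∣ · 1#)
    fromℤ-signAbs i = ≡.subst (λ j → fromℤ j ≈ σ (ℤ.sign i) * (ℤ.∣ i ∣ · 1#))
                              (ℤP.◃-inverse i) (◃-homo (ℤ.sign i) ℤ.∣ i ∣)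

    1+-cancel : ∀ a b → (1# + a) + - (1# + b) ≈ a + - b
    1+-cancel a b = begin
      (1# + a) + - (1# + b)   ≈⟨ +-congˡ (-‿+-comm 1# b) ⟨
      (1# + a) + (- 1# + - b) ≈⟨ +-interchange 1# a (- 1#) (- b) ⟩
      (1# + - 1#) + (a + - b) ≈⟨ +-congʳ (-‿inverseʳ 1#) ⟩
      0# + (a + - b)          ≈⟨ +-identityˡ _ ⟩
      a + - b                 ∎

    ⊖-homo : ∀ m n → fromℤ (m ℤ.⊖ n) ≈ m · 1# + - (n · 1#)
    ⊖-homo zero    zero    = sym (trans (+-congˡ -0#≈0#) (+-identityʳ 0#))
    ⊖-homo zero    (suc n) = sym (+-identityˡ _)
    ⊖-homo (suc m) zero    = sym (trans (+-congˡ -0#≈0#) (+-identityʳ _))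
    ⊖-homo (suc m) (suc n) = begin
      fromℤ (suc m ℤ.⊖ suc n)           ≡⟨ ≡.cong fromℤ (ℤP.[1+m]⊖[1+n]≡m⊖n m n) ⟩
      fromℤ (m ℤ.⊖ n)                   ≈⟨ ⊖-homo m n ⟩
      m · 1# + - (n · 1#)             ≈⟨ 1+-cancel _ _ ⟨
      (1# + m · 1#) + - (1# + n · 1#) ≈⟨ +-cong (×-homo-+ 1# 1 m) (-‿cong (×-homo-+ 1# 1 n)) ⟨
      suc m · 1# + - (suc n · 1#)     ∎

    +-homo : ∀ i j → fromℤ (i ℤ.+ j) ≈ fromℤ i + fromℤ j
    +-homo (+ m)    (+ n)    = ×-homo-+ 1# m n
    +-homo (+ m)    -[1+ n ] = ⊖-homo m (suc n)
    +-homo -[1+ m ] (+ n)    = trans (⊖-homo n (suc m)) (+-comm _ _)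
    +-homo -[1+ m ] -[1+ n ] = begin
      - (suc (suc (m ℕ.+ n)) · 1#)     ≡⟨ ≡.cong (λ k → - (suc k · 1#)) (ℕP.+-suc m n) ⟨
      - ((suc m ℕ.+ suc n) · 1#)       ≈⟨ -‿cong (×-homo-+ 1# (suc m) (suc n)) ⟩
      - (suc m · 1# + suc n · 1#)      ≈⟨ -‿+-comm _ _ ⟨
      - (suc m · 1#) + - (suc n · 1#)  ∎

    *-homo : ∀ i j → fromℤ (i ℤ.* j) ≈ fromℤ i * fromℤ j
    *-homo i j = begin
      fromℤ ((ℤ.sign i Sign.* ℤ.sign j) ℤ.◃ (ℤ.∣ i ∣ ℕ.* ℤ.∣ j ∣))
        ≈⟨ ◃-homo (ℤ.sign i Sign.* ℤ.sign j) (ℤ.∣ i ∣ ℕ.* ℤ.∣ j ∣) ⟩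
      σ (ℤ.sign i Sign.* ℤ.sign j) * ((ℤ.∣ i ∣ ℕ.* ℤ.∣ j ∣) · 1#)
        ≈⟨ *-cong (σ-homo (ℤ.sign i) (ℤ.sign j)) (×1-homo-* ℤ.∣ i ∣ ℤ.∣ j ∣) ⟩
      (σ (ℤ.sign i) * σ (ℤ.sign j)) * ((ℤ.∣ i ∣ · 1#) * (ℤ.∣ j ∣ · 1#))
        ≈⟨ *-interchange _ _ _ _ ⟩
      (σ (ℤ.sign i) * (ℤ.∣ i ∣ · 1#)) * (σ (ℤ.sign j) * (ℤ.∣ j ∣ · 1#))
        ≈⟨ *-cong (fromℤ-signAbs i) (fromℤ-signAbs j) ⟨
      fromℤ i * fromℤ j ∎

    -‿homo : ∀ i → fromℤ (ℤ.- i) ≈ - fromℤ i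
    -‿homo (+ zero)  = sym -0#≈0#
    -‿homo (+ suc n) = refl
    -‿homo -[1+ n ]  = sym (-‿involutive _)

    integerHomomorphism : ℤ.+-*-rawRing -Raw-AlmostCommutative⟶ fromCommutativeRing R
    integerHomomorphism = record
      { ⟦_⟧ = fromℤ ; +-homo = +-homo ; *-homo = *-homo ; -‿homo = -‿homo
      ; 0-homo = refl ; 1-homo = refl }

    fromℤ-≟ : ∀ i j → Maybe (fromℤ i ≈ fromℤ j)
    fromℤ-≟ i j with i ℤ.≟ j
    ... | yes ≡.refl = just refl
    ... | no _       = nothing

  open Algebra.Solver.Ring ℤ.+-*-rawRing (fromCommutativeRing R) integerHomomorphism fromℤ-≟ public
    using (solve; _:=_; _:+_; _:*_; :-_; con)

module Properties {c ℓ} (R : CommutativeRing c ℓ) where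
  open CommutativeRing R hiding (zero)
  open IntegerCoefficientSolver R
  open import Relation.Binary.Reasoning.Setoid setoid

  sumTo-cong : ∀ m {f g : ℕ → Carrier} → (∀ k → f k ≈ g k) → sumTo R m f ≈ sumTo R m g
  sumTo-cong zero    f≈g = f≈g zero
  sumTo-cong (suc m) f≈g = +-cong (sumTo-cong m f≈g) (f≈g (suc m))

  sumTo-+ : ∀ m (f g : ℕ → Carrier) → sumTo R m (λ k → f k + g k) ≈ sumTo R m f + sumTo R m g
  sumTo-+ zero    f g = refl
  sumTo-+ (suc m) f g = trans (+-congʳ (sumTo-+ m f g))
    (solve 4 (λ a b c d → (a :+ b) :+ (c :+ d) := (a :+ c) :+ (b :+ d)) refl _ _ _ _)

  sumTo-*ˡ : ∀ m a (f : ℕ → Carrier) → sumTo R m (λ k → a * f k) ≈ a * sumTo R m f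
  sumTo-*ˡ zero    a f = refl
  sumTo-*ˡ (suc m) a f = trans (+-congʳ (sumTo-*ˡ m a f)) (sym (distribˡ a _ _))

  sumTo-suc : ∀ m (f : ℕ → Carrier) → sumTo R (suc m) f ≈ f 0 + sumTo R m (λ k → f (suc k))
  sumTo-suc zero    f = refl
  sumTo-suc (suc m) f = trans (+-congʳ (sumTo-suc m f)) (+-assoc _ _ _)

  sumTo-linear : ∀ m α β (F : ℕ → Carrier) →
    sumTo R m (λ k → (α + β * fromℕ R k) * F k)
      ≈ α * sumTo R m F + β * sumTo R m (λ k → fromℕ R k * F k)
  sumTo-linear m α β F = begin
    sumTo R m (λ k → (α + β * fromℕ R k) * F k)
      ≈⟨ sumTo-cong m (λ k → solve 4 (λ α β n f → (α :+ β :* n) :* f := α :* f :+ β :* (n :* f))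
                                       refl α β (fromℕ R k) (F k)) ⟩
    sumTo R m (λ k → α * F k + β * (fromℕ R k * F k))
      ≈⟨ sumTo-+ m _ _ ⟩
    sumTo R m (λ k → α * F k) + sumTo R m (λ k → β * (fromℕ R k * F k))
      ≈⟨ +-cong (sumTo-*ˡ m α F) (sumTo-*ˡ m β _) ⟩
    α * sumTo R m F + β * sumTo R m (λ k → fromℕ R k * F k) ∎

  E-vanishes : ∀ a₁ a₂ n k → n < k → E R a₁ a₂ n k ≈ 0#
  E-vanishes a₁ a₂ zero    (suc k) _       = refl
  E-vanishes a₁ a₂ (suc n) (suc k) (s≤s p) =
    trans (+-cong (*-congˡ (E-vanishes a₁ a₂ n (suc k) (ℕP.m<n⇒m<1+n p)))
                  (*-congˡ (E-vanishes a₁ a₂ n k p)))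
          (solve 2 (λ a b → a :* con (+ 0) :+ b :* con (+ 0) := con (+ 0)) refl _ _)

  θEpoly : Carrier → Carrier → ℕ → Carrier → Carrier
  θEpoly a₁ a₂ n x = sumTo R n (λ k → fromℕ R k * (E R a₁ a₂ n k * pow R x k))

  Epoly-suc : ∀ a₁ a₂ n x →
    Epoly R a₁ a₂ (suc n) x
      ≈ (a₂ * (1# + x) + a₁ * (fromℕ R n * x)) * Epoly R a₁ a₂ n x
        + (a₁ * (1# + - x)) * θEpoly a₁ a₂ n x
  Epoly-suc a₁ a₂ n x = begin
    Epoly R a₁ a₂ (suc n) x
      ≈⟨ sumTo-suc n _ ⟩
    E R a₁ a₂ (suc n) 0 * pow R x 0 + sumTo R n (λ j → E R a₁ a₂ (suc n) (suc j) * pow R x (suc j))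
      ≈⟨ +-cong first (trans (sumTo-cong n split)
                              (trans (sumTo-+ n _ _) (+-congˡ (sumTo-*ˡ n x h)))) ⟩
    g 0 + (sumTo R n (λ j → g (suc j)) + x * sumTo R n h)
      ≈⟨ +-assoc _ _ _ ⟨
    (g 0 + sumTo R n (λ j → g (suc j))) + x * sumTo R n h
      ≈⟨ +-congʳ (sumTo-suc n g) ⟨
    (sumTo R n g + g (suc n)) + x * sumTo R n h
      ≈⟨ +-cong (trans (+-congˡ top) (+-identityʳ _)) refl ⟩
    sumTo R n g + x * sumTo R n h
      ≈⟨ +-cong (sumTo-linear n a₂ a₁ F)
                (*-congˡ (sumTo-linear n (a₁ * fromℕ R n + a₂) (- a₁) F)) ⟩
    (a₂ * Ev + a₁ * θ) + x * ((a₁ * fromℕ R n + a₂) * Ev + (- a₁) * θ)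
      ≈⟨ solve 6 (λ a₁ a₂ x n Ev θ →
             (a₂ :* Ev :+ a₁ :* θ) :+ x :* ((a₁ :* n :+ a₂) :* Ev :+ (:- a₁) :* θ)
             := (a₂ :* (con (+ 1) :+ x) :+ a₁ :* (n :* x)) :* Ev :+ (a₁ :* (con (+ 1) :+ :- x)) :* θ)
           refl a₁ a₂ x (fromℕ R n) Ev θ ⟩
    (a₂ * (1# + x) + a₁ * (fromℕ R n * x)) * Ev + (a₁ * (1# + - x)) * θ ∎
    where
    e : ℕ → Carrier
    e = E R a₁ a₂ n
    Ev θ : Carrier
    Ev = Epoly R a₁ a₂ n x
    θ = θEpoly a₁ a₂ n x
    F : ℕ → Carrier
    F k = e k * pow R x k
    g h : ℕ → Carrier
    g k = (a₂ + a₁ * fromℕ R k) * F k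
    h j = ((a₁ * fromℕ R n + a₂) + (- a₁) * fromℕ R j) * F j
    first : E R a₁ a₂ (suc n) 0 * pow R x 0 ≈ g 0
    first = solve 3 (λ a₁ a₂ e → (a₁ :* con (+ 0) :+ a₂) :* e :* con (+ 1)
                                  := (a₂ :+ a₁ :* con (+ 0)) :* (e :* con (+ 1))) refl a₁ a₂ (e 0)
    split : ∀ j → E R a₁ a₂ (suc n) (suc j) * pow R x (suc j) ≈ g (suc j) + x * h j
    split j = solve 8 (λ a₁ a₂ x j n e₁ e₀ p →
      ((a₁ :* (con (+ 1) :+ j) :+ a₂) :* e₁
         :+ ((a₁ :* (con (+ 1) :+ n) :+ :- (a₁ :* (con (+ 1) :+ j))) :+ a₂) :* e₀) :* (x :* p)
      := (a₂ :+ a₁ :* (con (+ 1) :+ j)) :* (e₁ :* (x :* p))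
         :+ x :* (((a₁ :* n :+ a₂) :+ (:- a₁) :* j) :* (e₀ :* p)))
      refl a₁ a₂ x (fromℕ R j) (fromℕ R n) (e (suc j)) (e j) (pow R x j)
    top : g (suc n) ≈ 0#
    top = trans (*-congˡ (*-congʳ (E-vanishes a₁ a₂ n (suc n) (ℕP.n<1+n n))))
                (solve 2 (λ a p → a :* (con (+ 0) :* p) := con (+ 0)) refl _ _)

  evalₚ-+ₚ : ∀ p q t → evalₚ R (_+ₚ_ R p q) t ≈ evalₚ R p t + evalₚ R q t
  evalₚ-+ₚ []      q       t = sym (+-identityˡ _)
  evalₚ-+ₚ (a ∷ p) []      t = sym (+-identityʳ _)
  evalₚ-+ₚ (a ∷ p) (b ∷ q) t = trans (+-congˡ (*-congˡ (evalₚ-+ₚ p q t)))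
    (solve 5 (λ a b t P Q → (a :+ b) :+ t :* (P :+ Q) := (a :+ t :* P) :+ (b :+ t :* Q)) refl a b t _ _)

  evalₚ-scaleₚ : ∀ a p t → evalₚ R (scaleₚ R a p) t ≈ a * evalₚ R p t
  evalₚ-scaleₚ a []      t = sym (zeroʳ a)
  evalₚ-scaleₚ a (b ∷ p) t = trans (+-congˡ (*-congˡ (evalₚ-scaleₚ a p t)))
    (solve 4 (λ a b t P → a :* b :+ t :* (a :* P) := a :* (b :+ t :* P)) refl a b t _)

  evalₚ-derivAux-suc : ∀ k p t →
    evalₚ R (derivAux R (suc k) p) t ≈ evalₚ R p t + evalₚ R (derivAux R k p) t
  evalₚ-derivAux-suc k []      t = sym (+-identityˡ 0#)
  evalₚ-derivAux-suc k (b ∷ p) t = trans (+-congˡ (*-congˡ (evalₚ-derivAux-suc (suc k) p t)))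
    (solve 5 (λ k b t P D → (con (+ 1) :+ k) :* b :+ t :* (P :+ D) := (b :+ t :* P) :+ (k :* b :+ t :* D))
       refl (fromℕ R k) b t _ _)

  evalₚ-derivAux-zero : ∀ p t → evalₚ R (derivAux R 0 p) t ≈ t * evalₚ R (deriv R p) t
  evalₚ-derivAux-zero []      t = sym (zeroʳ t)
  evalₚ-derivAux-zero (b ∷ p) t = solve 3 (λ b t D → con (+ 0) :* b :+ t :* D := t :* D) refl b t _

  evalₚ-deriv-∷ : ∀ b p t → evalₚ R (deriv R (b ∷ p)) t ≈ evalₚ R p t + t * evalₚ R (deriv R p) t
  evalₚ-deriv-∷ b p t = trans (evalₚ-derivAux-suc 0 p t) (+-congˡ (evalₚ-derivAux-zero p t))

  Qeval-suc : ∀ δ n t →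
    Qeval R δ (suc n) t ≈ (1# + t * t) * evalₚ R (deriv R (Q R δ n)) t + (δ * t) * Qeval R δ n t
  Qeval-suc δ n t = begin
    Qeval R δ (suc n) t
      ≈⟨ evalₚ-+ₚ (_+ₚ_ R q′ (shiftₚ R (shiftₚ R q′))) _ t ⟩
    evalₚ R (_+ₚ_ R q′ (shiftₚ R (shiftₚ R q′))) t + evalₚ R (scaleₚ R δ (shiftₚ R q)) t
      ≈⟨ +-cong (evalₚ-+ₚ q′ _ t) (evalₚ-scaleₚ δ (shiftₚ R q) t) ⟩
    (D + (0# + t * (0# + t * D))) + δ * (0# + t * Qeval R δ n t)
      ≈⟨ solve 4 (λ D t δ Q → (D :+ (con (+ 0) :+ t :* (con (+ 0) :+ t :* D))) :+ δ :* (con (+ 0) :+ t :* Q)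
                            := (con (+ 1) :+ t :* t) :* D :+ (δ :* t) :* Q) refl D t δ _ ⟩
    (1# + t * t) * D + (δ * t) * Qeval R δ n t ∎
    where
    q q′ : Poly R
    q = Q R δ n
    q′ = deriv R q
    D : Carrier
    D = evalₚ R q′ t

  pow′ : Carrier → ℕ → Carrier
  pow′ a zero    = 0#
  pow′ a (suc n) = pow R a n + a * pow′ a n

  *-pow′ : ∀ a n → a * pow′ a n ≈ fromℕ R n * pow R a n
  *-pow′ a zero    = trans (zeroʳ a) (sym (zeroˡ 1#))
  *-pow′ a (suc n) = trans (distribˡ a _ _) (trans (+-congˡ (*-congˡ (*-pow′ a n)))
    (solve 3 (λ a n p → a :* p :+ a :* (n :* p) := (con (+ 1) :+ n) :* (a :* p))
       refl a (fromℕ R n) (pow R a n)))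

module Homomorphism {c₁ ℓ₁ c₂ ℓ₂} (R : CommutativeRing c₁ ℓ₁) (S : CommutativeRing c₂ ℓ₂)
  {h : CommutativeRing.Carrier R → CommutativeRing.Carrier S}
  (isHom : IsRingHomomorphism (CommutativeRing.rawRing R) (CommutativeRing.rawRing S) h) where
  private module R = CommutativeRing R
  open CommutativeRing S hiding (zero)
  open IsRingHomomorphism isHom public

  infix 4 _↦ₚ_
  _↦ₚ_ : Poly R → Poly S → Set (c₁ ⊔ c₂ ⊔ ℓ₂)
  _↦ₚ_ = Pointwise (λ a b → h a ≈ b)

  fromℕ-homo : ∀ n → h (fromℕ R n) ≈ fromℕ S n
  fromℕ-homo zero    = 0#-homo
  fromℕ-homo (suc n) = trans (+-homo R.1# (fromℕ R n)) (+-cong 1#-homo (fromℕ-homo n))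

  +-homo≈ : ∀ {a b α β} → h a ≈ α → h b ≈ β → h (a R.+ b) ≈ α + β
  +-homo≈ p q = trans (+-homo _ _) (+-cong p q)

  *-homo≈ : ∀ {a b α β} → h a ≈ α → h b ≈ β → h (a R.* b) ≈ α * β
  *-homo≈ p q = trans (*-homo _ _) (*-cong p q)

  -‿homo≈ : ∀ {a α} → h a ≈ α → h (R.- a) ≈ - α
  -‿homo≈ p = trans (-‿homo _) (-‿cong p)

  E-homo : ∀ {a₁ a₂ b₁ b₂} → h a₁ ≈ b₁ → h a₂ ≈ b₂ → ∀ n k → h (E R a₁ a₂ n k) ≈ E S b₁ b₂ n k
  E-homo p₁ p₂ zero    zero    = 1#-homo
  E-homo p₁ p₂ zero    (suc k) = 0#-homo
  E-homo p₁ p₂ (suc n) zero    =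
    *-homo≈ (+-homo≈ (*-homo≈ p₁ (fromℕ-homo 0)) p₂) (E-homo p₁ p₂ n zero)
  E-homo p₁ p₂ (suc n) (suc k) =
    +-homo≈ (*-homo≈ (+-homo≈ (*-homo≈ p₁ (fromℕ-homo (suc k))) p₂) (E-homo p₁ p₂ n (suc k)))
            (*-homo≈ (+-homo≈ (+-homo≈ (*-homo≈ p₁ (fromℕ-homo (suc n)))
                                       (-‿homo≈ (*-homo≈ p₁ (fromℕ-homo (suc k)))))
                              p₂)
                     (E-homo p₁ p₂ n k))

  +ₚ-homo : ∀ {p q P Q} → p ↦ₚ P → q ↦ₚ Q → _+ₚ_ R p q ↦ₚ _+ₚ_ S P Q
  +ₚ-homo []       q↦Q       = q↦Q
  +ₚ-homo (a ∷ p↦P) []       = a ∷ p↦P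
  +ₚ-homo (a ∷ p↦P) (b ∷ q↦Q) = +-homo≈ a b ∷ +ₚ-homo p↦P q↦Q

  scaleₚ-homo : ∀ {a α p P} → h a ≈ α → p ↦ₚ P → scaleₚ R a p ↦ₚ scaleₚ S α P
  scaleₚ-homo a []        = []
  scaleₚ-homo a (b ∷ p↦P) = *-homo≈ a b ∷ scaleₚ-homo a p↦P

  shiftₚ-homo : ∀ {p P} → p ↦ₚ P → shiftₚ R p ↦ₚ shiftₚ S P
  shiftₚ-homo p↦P = 0#-homo ∷ p↦P

  derivAux-homo : ∀ k {p P} → p ↦ₚ P → derivAux R k p ↦ₚ derivAux S k P
  derivAux-homo k []        = []
  derivAux-homo k (b ∷ p↦P) = *-homo≈ (fromℕ-homo k) b ∷ derivAux-homo (suc k) p↦P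

  deriv-homo : ∀ {p P} → p ↦ₚ P → deriv R p ↦ₚ deriv S P
  deriv-homo []        = []
  deriv-homo (_ ∷ p↦P) = derivAux-homo 1 p↦P

  Q-homo : ∀ {δ Δ} → h δ ≈ Δ → ∀ n → Q R δ n ↦ₚ Q S Δ n
  Q-homo δ↦Δ zero    = 1#-homo ∷ []
  Q-homo {δ} {Δ} δ↦Δ (suc n) =
    +ₚ-homo (+ₚ-homo q′ (shiftₚ-homo (shiftₚ-homo q′))) (scaleₚ-homo δ↦Δ (shiftₚ-homo q))
    where
    q : Q R δ n ↦ₚ Q S Δ n
    q = Q-homo δ↦Δ n
    q′ : deriv R (Q R δ n) ↦ₚ deriv S (Q S Δ n)
    q′ = deriv-homo q

module DualNumbers {c ℓ} (R : CommutativeRing c ℓ) where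
  open CommutativeRing R hiding (zero)
  open IntegerCoefficientSolver R
  open Properties R
  private module ⋉ = Idealization ring TensorUnit.bimodule

  -- (a , α) stands for a + αε with ε² = 0.
  Dual : CommutativeRing c ℓ
  Dual = record
    { isCommutativeRing = record
      { isRing = ⋉.isRingᴺ
      ; *-comm = λ (a , α) (b , β) →
          *-comm a b , trans (+-comm (a * β) (α * b)) (+-cong (*-comm α b) (*-comm a β))
      }
    }

  private module D = CommutativeRing Dual

  ι : Carrier → D.Carrier
  ι a = a , 0#

  ι-isRingHomomorphism : IsRingHomomorphism rawRing D.rawRing ι
  ι-isRingHomomorphism = record
    { isSemiringHomomorphism = record
      { isNearSemiringHomomorphism = record
        { +-isMonoidHomomorphism = record
          { isMagmaHomomorphism = record
            { isRelHomomorphism = record { cong = λ a≈b → a≈b , refl }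
            ; homo = λ a b → refl , sym (+-identityʳ 0#)
            }
          ; ε-homo = D.refl
          }
        ; *-homo = λ a b →
            refl , solve 2 (λ a b → con (+ 0) := a :* con (+ 0) :+ con (+ 0) :* b) refl a b
        }
      ; 1#-homo = D.refl
      }
    ; -‿homo = λ a → refl , solve 0 (con (+ 0) := :- con (+ 0)) refl
    }

  private module ιHom = Homomorphism R Dual ι-isRingHomomorphism

  sumTo-dual : ∀ m (F : ℕ → D.Carrier) →
    sumTo Dual m F D.≈ (sumTo R m (λ k → proj₁ (F k)) , sumTo R m (λ k → proj₂ (F k)))
  sumTo-dual zero    F = D.refl
  sumTo-dual (suc m) F = +-congʳ (proj₁ (sumTo-dual m F)) , +-congʳ (proj₂ (sumTo-dual m F))

  pow-dual : ∀ a α n → pow Dual (a , α) n D.≈ (pow R a n , α * pow′ a n)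
  pow-dual a α zero    = refl , sym (zeroʳ α)
  pow-dual a α (suc n) = *-congˡ (proj₁ ih) , trans (+-cong (*-congˡ (proj₂ ih)) (*-congˡ (proj₁ ih)))
    (solve 4 (λ a α d p → a :* (α :* d) :+ α :* p := α :* (p :+ a :* d))
       refl a α (pow′ a n) (pow R a n))
    where
    ih : pow Dual (a , α) n D.≈ (pow R a n , α * pow′ a n)
    ih = pow-dual a α n

  evalₚ-dual : ∀ {p P} → ιHom._↦ₚ_ p P → ∀ t τ →
    evalₚ Dual P (t , τ) D.≈ (evalₚ R p t , τ * evalₚ R (deriv R p) t)
  evalₚ-dual []                  t τ = refl , sym (zeroʳ τ)
  evalₚ-dual {b ∷ p} {_ ∷ P} (b↦B ∷ p↦P) t τ =
    +-cong (sym (proj₁ b↦B)) (*-congˡ (proj₁ ih)) ,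
    trans (+-cong (sym (proj₂ b↦B)) (+-cong (*-congˡ (proj₂ ih)) (*-congˡ (proj₁ ih))))
          (trans (solve 4 (λ t τ D V → con (+ 0) :+ (t :* (τ :* D) :+ τ :* V) := τ :* (V :+ t :* D))
                    refl t τ (evalₚ R (deriv R p) t) (evalₚ R p t))
                 (*-congˡ (sym (evalₚ-deriv-∷ b p t))))
    where
    ih : evalₚ Dual P (t , τ) D.≈ (evalₚ R p t , τ * evalₚ R (deriv R p) t)
    ih = evalₚ-dual p↦P t τ

  Epoly-dual : ∀ a₁ a₂ n x →
    Epoly Dual (ι a₁) (ι a₂) n (x , x) D.≈ (Epoly R a₁ a₂ n x , θEpoly a₁ a₂ n x)
  Epoly-dual a₁ a₂ n x = D.trans (sumTo-dual n _) (sumTo-cong n value , sumTo-cong n slope)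
    where
    e↦E : ∀ k → ι (E R a₁ a₂ n k) D.≈ E Dual (ι a₁) (ι a₂) n k
    e↦E = ιHom.E-homo D.refl D.refl n
    value : ∀ k → proj₁ (E Dual (ι a₁) (ι a₂) n k) * proj₁ (pow Dual (x , x) k)
                  ≈ E R a₁ a₂ n k * pow R x k
    value k = *-cong (sym (proj₁ (e↦E k))) (proj₁ (pow-dual x x k))
    slope : ∀ k → proj₁ (E Dual (ι a₁) (ι a₂) n k) * proj₂ (pow Dual (x , x) k)
                    + proj₂ (E Dual (ι a₁) (ι a₂) n k) * proj₁ (pow Dual (x , x) k)
                  ≈ fromℕ R k * (E R a₁ a₂ n k * pow R x k)
    slope k = trans (+-cong (*-cong (sym (proj₁ (e↦E k)))
                                    (trans (proj₂ (pow-dual x x k)) (*-pow′ x k)))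
                            (*-congʳ (sym (proj₂ (e↦E k)))))
      (solve 4 (λ e n p q → e :* (n :* p) :+ con (+ 0) :* q := n :* (e :* p)) refl _ _ _ _)

EpolyFormula : ∀ {c ℓ} → CommutativeRing c ℓ → ℕ → Set (c ⊔ ℓ)
EpolyFormula R n = let open CommutativeRing R in
    (i : Carrier) → i * i ≈ - 1# →
    (half : Carrier) → (1# + 1#) * half ≈ 1# →
    (a₁ a₂ a₁⁻¹ : Carrier) → a₁ * a₁⁻¹ ≈ 1# →
    (x y : Carrier) → (1# + - x) * y ≈ 1# →
    Epoly R a₁ a₂ n x
      ≈ (pow R ((a₁ * i) * half) n * pow R (1# + - x) n)
        * Qeval R (((1# + 1#) * a₂) * a₁⁻¹) n (((1# + x) * y) * (- i))

EpolyFormula-zero : ∀ {c ℓ} (R : CommutativeRing c ℓ) → EpolyFormula R 0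
EpolyFormula-zero R i _ h _ a₁ a₂ a₁⁻¹ _ x y _ =
  solve 1 (λ t → con (+ 1) :* con (+ 1) := (con (+ 1) :* con (+ 1)) :* (con (+ 1) :+ t :* con (+ 0)))
    refl (((1# + x) * y) * (- i))
  where
  open CommutativeRing R using (_+_; _*_; -_; 1#; refl)
  open IntegerCoefficientSolver R

module Substitution {r ℓ} (R : CommutativeRing r ℓ) where
  open CommutativeRing R hiding (zero)

  module _ (i : Carrier) (i²≈-1 : i * i ≈ - 1#)
    (h : Carrier) (2h≈1 : (1# + 1#) * h ≈ 1#)
    (a₁ a₂ a₁⁻¹ : Carrier) (a₁a₁⁻¹≈1 : a₁ * a₁⁻¹ ≈ 1#)
    (x y : Carrier) (uy≈1 : (1# + - x) * y ≈ 1#) where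
    open IntegerCoefficientSolver R
    open Properties R
    open DualNumbers R
    open import Relation.Binary.Reasoning.Setoid setoid
    private
      module D = CommutativeRing Dual
      module ιHom = Homomorphism R Dual ι-isRingHomomorphism

    c u δ t : Carrier
    c = (a₁ * i) * h
    u = 1# + - x
    δ = ((1# + 1#) * a₂) * a₁⁻¹
    t = ((1# + x) * y) * (- i)

    -- Y = 1/(1 - X) at X = x + xε, so τ = θt.
    X Y T : D.Carrier
    X = x , x
    Y = y , x * (y * y)
    T = ((D.1# D.+ X) D.* Y) D.* (D.- ι i)

    τ : Carrier
    τ = proj₂ T

    cuδt≈a₂[1+x] : ((c * u) * δ) * t ≈ a₂ * (1# + x)
    cuδt≈a₂[1+x] = begin
      ((c * u) * δ) * t
        ≈⟨ solve 7 (λ a₁ a₁⁻¹ a₂ i h x y →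
             ((((a₁ :* i) :* h) :* (con (+ 1) :+ :- x)) :* (((con (+ 1) :+ con (+ 1)) :* a₂) :* a₁⁻¹))
               :* (((con (+ 1) :+ x) :* y) :* (:- i))
             := (a₁ :* a₁⁻¹) :* (((con (+ 1) :+ con (+ 1)) :* h) :* ((:- (i :* i))
                   :* (((con (+ 1) :+ :- x) :* y) :* (a₂ :* (con (+ 1) :+ x))))))
           refl a₁ a₁⁻¹ a₂ i h x y ⟩
      (a₁ * a₁⁻¹) * (((1# + 1#) * h) * ((- (i * i)) * ((u * y) * (a₂ * (1# + x)))))
        ≈⟨ *-cong a₁a₁⁻¹≈1 (*-cong 2h≈1 (*-cong (-‿cong i²≈-1) (*-congʳ uy≈1))) ⟩
      1# * (1# * ((- - 1#) * (1# * (a₂ * (1# + x)))))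
        ≈⟨ solve 1 (λ w → con (+ 1) :* (con (+ 1) :* ((:- :- con (+ 1)) :* (con (+ 1) :* w))) := w) refl _ ⟩
      a₂ * (1# + x) ∎

    c[1+t²]≈a₁τ : c * (1# + t * t) ≈ a₁ * τ
    c[1+t²]≈a₁τ = trans c[1+t²]≈w (sym a₁τ≈w)
      where
      w : Carrier
      w = - ((a₁ * i) * ((x * y) * ((1# + 1#) * y)))
      c[1+t²]≈w : c * (1# + t * t) ≈ w
      c[1+t²]≈w = begin
        c * (1# + t * t)
          ≈⟨ *-congˡ (+-congʳ (sym (trans (*-cong uy≈1 uy≈1) (*-identityˡ 1#)))) ⟩
        c * ((u * y) * (u * y) + t * t)
          ≈⟨ solve 5 (λ a₁ i h x y →
               ((a₁ :* i) :* h) :* (((con (+ 1) :+ :- x) :* y) :* ((con (+ 1) :+ :- x) :* y)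
                 :+ (((con (+ 1) :+ x) :* y) :* (:- i)) :* (((con (+ 1) :+ x) :* y) :* (:- i)))
               := ((con (+ 1) :+ con (+ 1)) :* h)
                    :* (:- ((a₁ :* i) :* ((x :* y) :* ((con (+ 1) :+ con (+ 1)) :* y))))
                  :+ (((a₁ :* i) :* h) :* (((con (+ 1) :+ x) :* y) :* ((con (+ 1) :+ x) :* y)))
                    :* (i :* i :+ con (+ 1)))
             refl a₁ i h x y ⟩
        ((1# + 1#) * h) * w + (c * (((1# + x) * y) * ((1# + x) * y))) * (i * i + 1#)
          ≈⟨ +-cong (*-congʳ 2h≈1) (*-congˡ (trans (+-congʳ i²≈-1) (-‿inverseˡ 1#))) ⟩
        1# * w + (c * (((1# + x) * y) * ((1# + x) * y))) * 0#
          ≈⟨ solve 2 (λ w v → con (+ 1) :* w :+ v :* con (+ 0) := w) refl w _ ⟩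
        w ∎
      a₁τ≈w : a₁ * τ ≈ w
      a₁τ≈w = begin
        a₁ * τ
          ≈⟨ solve 4 (λ a₁ i x y →
               a₁ :* (((con (+ 1) :+ x) :* y) :* (:- con (+ 0))
                      :+ ((con (+ 1) :+ x) :* (x :* (y :* y)) :+ (con (+ 0) :+ x) :* y) :* (:- i))
               := :- ((a₁ :* i) :* ((x :* y) :* (con (+ 1) :+ (con (+ 1) :+ x) :* y))))
             refl a₁ i x y ⟩
        - ((a₁ * i) * ((x * y) * (1# + (1# + x) * y)))
          ≈⟨ -‿cong (*-congˡ (*-congˡ (+-congʳ (sym uy≈1)))) ⟩
        - ((a₁ * i) * ((x * y) * (u * y + (1# + x) * y)))
          ≈⟨ solve 4 (λ a₁ i x y →
               :- ((a₁ :* i) :* ((x :* y) :* ((con (+ 1) :+ :- x) :* y :+ (con (+ 1) :+ x) :* y)))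
               := :- ((a₁ :* i) :* ((x :* y) :* ((con (+ 1) :+ con (+ 1)) :* y))))
             refl a₁ i x y ⟩
        w ∎

    module _ (n : ℕ) (formula : EpolyFormula Dual n) where
      M Qv Q′v : Carrier
      M   = pow R c n * pow R u n
      Qv  = Qeval R δ n t
      Q′v = evalₚ R (deriv R (Q R δ n)) t

      private
        2↦2 : ι (1# + 1#) D.≈ D.1# D.+ D.1#
        2↦2 = ιHom.+-homo≈ ιHom.1#-homo ιHom.1#-homo
        i²≈-1ᴰ : ι i D.* ι i D.≈ D.- D.1#
        i²≈-1ᴰ = D.trans (D.sym (ιHom.*-homo i i)) (D.trans (ιHom.⟦⟧-cong i²≈-1) (ιHom.-‿homo 1#))
        2h≈1ᴰ : (D.1# D.+ D.1#) D.* ι h D.≈ D.1#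
        2h≈1ᴰ = D.trans (D.sym (ιHom.*-homo≈ 2↦2 (D.refl {ι h}))) (ιHom.⟦⟧-cong 2h≈1)
        a₁a₁⁻¹≈1ᴰ : ι a₁ D.* ι a₁⁻¹ D.≈ D.1#
        a₁a₁⁻¹≈1ᴰ = D.trans (D.sym (ιHom.*-homo a₁ a₁⁻¹)) (ιHom.⟦⟧-cong a₁a₁⁻¹≈1)
        uy≈1ᴰ : (D.1# D.+ D.- X) D.* Y D.≈ D.1#
        uy≈1ᴰ = uy≈1 , (begin
          u * (x * (y * y)) + (0# + - x) * y
            ≈⟨ solve 2 (λ x y → (con (+ 1) :+ :- x) :* (x :* (y :* y)) :+ (con (+ 0) :+ :- x) :* y
                               := (x :* y) :* ((con (+ 1) :+ :- x) :* y) :+ :- (x :* y)) refl x y ⟩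
          (x * y) * (u * y) + - (x * y)
            ≈⟨ +-congʳ (trans (*-congˡ uy≈1) (*-identityʳ (x * y))) ⟩
          x * y + - (x * y)
            ≈⟨ -‿inverseʳ (x * y) ⟩
          0# ∎)

        formula-at-X : Epoly Dual (ι a₁) (ι a₂) n X
              D.≈ (pow Dual ((ι a₁ D.* ι i) D.* ι h) n D.* pow Dual (D.1# D.+ D.- X) n)
                  D.* Qeval Dual (((D.1# D.+ D.1#) D.* ι a₂) D.* ι a₁⁻¹) n T
        formula-at-X = formula (ι i) i²≈-1ᴰ (ι h) 2h≈1ᴰ (ι a₁) (ι a₂) (ι a₁⁻¹) a₁a₁⁻¹≈1ᴰ X Y uy≈1ᴰ

        -- the ε-part of (ι a₁ D.* ι i) D.* ι h
        γ : Carrier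
        γ = (a₁ * i) * 0# + (a₁ * 0# + 0# * i) * h
        γ≈0 : γ ≈ 0#
        γ≈0 = solve 3 (λ a₁ i h →
                (a₁ :* i) :* con (+ 0) :+ (a₁ :* con (+ 0) :+ con (+ 0) :* i) :* h := con (+ 0))
              refl a₁ i h

        cⁿ : pow Dual (c , γ) n D.≈ (pow R c n , γ * pow′ c n)
        cⁿ = pow-dual c γ n
        uⁿ : pow Dual (u , 0# + - x) n D.≈ (pow R u n , (0# + - x) * pow′ u n)
        uⁿ = pow-dual u (0# + - x) n
        δ↦Δ : ι δ D.≈ ((D.1# D.+ D.1#) D.* ι a₂) D.* ι a₁⁻¹
        δ↦Δ = ιHom.*-homo≈ (ιHom.*-homo≈ 2↦2 (D.refl {ι a₂})) (D.refl {ι a₁⁻¹})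

        q : Qeval Dual (((D.1# D.+ D.1#) D.* ι a₂) D.* ι a₁⁻¹) n T D.≈ (Qv , τ * Q′v)
        q = evalₚ-dual (ιHom.Q-homo δ↦Δ n) t τ
        Eⁿ : Epoly Dual (ι a₁) (ι a₂) n X D.≈ (Epoly R a₁ a₂ n x , θEpoly a₁ a₂ n x)
        Eⁿ = Epoly-dual a₁ a₂ n x

      Epoly≈ : Epoly R a₁ a₂ n x ≈ M * Qv
      Epoly≈ = trans (sym (proj₁ Eⁿ))
        (trans (proj₁ formula-at-X) (*-cong (*-cong (proj₁ cⁿ) (proj₁ uⁿ)) (proj₁ q)))

      θEpoly≈ : θEpoly a₁ a₂ n x
                ≈ M * (τ * Q′v) + (pow R c n * ((0# + - x) * pow′ u n) + (γ * pow′ c n) * pow R u n) * Qv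
      θEpoly≈ = trans (sym (proj₂ Eⁿ)) (trans (proj₂ formula-at-X)
        (+-cong (*-cong (*-cong (proj₁ cⁿ) (proj₁ uⁿ)) (proj₂ q))
                (*-cong (+-cong (*-cong (proj₁ cⁿ) (proj₂ uⁿ)) (*-cong (proj₂ cⁿ) (proj₁ uⁿ))) (proj₁ q))))

      a₁uθEpoly≈ : (a₁ * u) * θEpoly a₁ a₂ n x
                   ≈ M * ((a₁ * τ) * (u * Q′v)) + - ((a₁ * (fromℕ R n * x)) * (M * Qv))
      a₁uθEpoly≈ = begin
        (a₁ * u) * θEpoly a₁ a₂ n x
          ≈⟨ *-congˡ θEpoly≈ ⟩
        (a₁ * u) * (M * (τ * Q′v) + (pow R c n * ((0# + - x) * pow′ u n) + (γ * pow′ c n) * pow R u n) * Qv)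
          ≈⟨ solve 11 (λ a₁ x τ Q′ Q cⁿ uⁿ γ c′ u′ n →
               (a₁ :* (con (+ 1) :+ :- x)) :* ((cⁿ :* uⁿ) :* (τ :* Q′)
                 :+ (cⁿ :* ((con (+ 0) :+ :- x) :* u′) :+ (γ :* c′) :* uⁿ) :* Q)
               := (cⁿ :* uⁿ) :* ((a₁ :* τ) :* ((con (+ 1) :+ :- x) :* Q′))
                  :+ :- (((a₁ :* x) :* (cⁿ :* Q)) :* ((con (+ 1) :+ :- x) :* u′))
                  :+ ((a₁ :* (con (+ 1) :+ :- x)) :* (c′ :* (uⁿ :* Q))) :* γ)
             refl a₁ x τ Q′v Qv (pow R c n) (pow R u n) γ (pow′ c n) (pow′ u n) (fromℕ R n) ⟩
        M * ((a₁ * τ) * (u * Q′v)) + - (((a₁ * x) * (pow R c n * Qv)) * (u * pow′ u n))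
          + ((a₁ * u) * (pow′ c n * (pow R u n * Qv))) * γ
          ≈⟨ +-cong (+-congˡ (-‿cong (*-congˡ (*-pow′ u n)))) (*-congˡ γ≈0) ⟩
        M * ((a₁ * τ) * (u * Q′v)) + - (((a₁ * x) * (pow R c n * Qv)) * (fromℕ R n * pow R u n))
          + ((a₁ * u) * (pow′ c n * (pow R u n * Qv))) * 0#
          ≈⟨ solve 8 (λ a₁ x n cⁿ uⁿ Q L P →
               L :+ :- (((a₁ :* x) :* (cⁿ :* Q)) :* (n :* uⁿ)) :+ P :* con (+ 0)
               := L :+ :- ((a₁ :* (n :* x)) :* ((cⁿ :* uⁿ) :* Q)))
             refl a₁ x (fromℕ R n) (pow R c n) (pow R u n) Qv _ _ ⟩
        M * ((a₁ * τ) * (u * Q′v)) + - ((a₁ * (fromℕ R n * x)) * (M * Qv)) ∎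

      Epoly-suc≈ : Epoly R a₁ a₂ (suc n) x
                   ≈ (pow R c (suc n) * pow R u (suc n)) * Qeval R δ (suc n) t
      Epoly-suc≈ = begin
        Epoly R a₁ a₂ (suc n) x
          ≈⟨ Epoly-suc a₁ a₂ n x ⟩
        (a₂ * (1# + x) + a₁ * (fromℕ R n * x)) * Epoly R a₁ a₂ n x + (a₁ * u) * θEpoly a₁ a₂ n x
          ≈⟨ +-cong (*-congˡ Epoly≈) a₁uθEpoly≈ ⟩
        (a₂ * (1# + x) + a₁ * (fromℕ R n * x)) * (M * Qv)
          + (M * ((a₁ * τ) * (u * Q′v)) + - ((a₁ * (fromℕ R n * x)) * (M * Qv)))
          ≈⟨ solve 5 (λ A B M Q D →
               (A :+ B) :* (M :* Q) :+ (M :* D :+ :- (B :* (M :* Q))) := M :* (A :* Q :+ D))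
             refl (a₂ * (1# + x)) (a₁ * (fromℕ R n * x)) M Qv _ ⟩
        M * ((a₂ * (1# + x)) * Qv + (a₁ * τ) * (u * Q′v))
          ≈⟨ *-congˡ (+-cong (*-congʳ cuδt≈a₂[1+x]) (*-congʳ c[1+t²]≈a₁τ)) ⟨
        M * ((((c * u) * δ) * t) * Qv + (c * (1# + t * t)) * (u * Q′v))
          ≈⟨ solve 8 (λ c u δ t cⁿ uⁿ Q Q′ →
               (cⁿ :* uⁿ) :* ((((c :* u) :* δ) :* t) :* Q :+ (c :* (con (+ 1) :+ t :* t)) :* (u :* Q′))
               := ((c :* cⁿ) :* (u :* uⁿ)) :* ((con (+ 1) :+ t :* t) :* Q′ :+ (δ :* t) :* Q))
             refl c u δ t (pow R c n) (pow R u n) Qv Q′v ⟩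
        (pow R c (suc n) * pow R u (suc n)) * ((1# + t * t) * Q′v + (δ * t) * Qv)
          ≈⟨ *-congˡ (Qeval-suc δ n t) ⟨
        (pow R c (suc n) * pow R u (suc n)) * Qeval R δ (suc n) t ∎

EpolyFormula-suc : ∀ {c ℓ} (R : CommutativeRing c ℓ) n →
  EpolyFormula (DualNumbers.Dual R) n → EpolyFormula R (suc n)
EpolyFormula-suc R n formula i i²≈-1 h 2h≈1 a₁ a₂ a₁⁻¹ a₁a₁⁻¹≈1 x y uy≈1 =
  Substitution.Epoly-suc≈ R i i²≈-1 h 2h≈1 a₁ a₂ a₁⁻¹ a₁a₁⁻¹≈1 x y uy≈1 n formula

epolyFormula : ∀ n {c ℓ} (R : CommutativeRing c ℓ) → EpolyFormula R n
epolyFormula zero    R = EpolyFormula-zero R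
epolyFormula (suc n) R = EpolyFormula-suc R n (epolyFormula n (DualNumbers.Dual R))

theorem3p6 : ∀ {c ℓ} (R : CommutativeRing c ℓ) →
    let open CommutativeRing R in
    (i : Carrier) → i * i ≈ - 1# →
    (half : Carrier) → (1# + 1#) * half ≈ 1# →
    (a₁ a₂ a₁⁻¹ : Carrier) → a₁ * a₁⁻¹ ≈ 1# →
    (x y : Carrier) → (1# + - x) * y ≈ 1# →
    (n : ℕ) →
    Epoly R a₁ a₂ n x
      ≈ (pow R ((a₁ * i) * half) n * pow R (1# + - x) n)
        * Qeval R (((1# + 1#) * a₂) * a₁⁻¹) n (((1# + x) * y) * (- i))
theorem3p6 R i i²≈-1 half 2half≈1 a₁ a₂ a₁⁻¹ a₁a₁⁻¹≈1 x y uy≈1 n =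
  epolyFormula n R i i²≈-1 half 2half≈1 a₁ a₂ a₁⁻¹ a₁a₁⁻¹≈1 x y uy≈1
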